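{- For $k>1$ and odd $n$, there are no nega-$\mathbb{Z}_{2^k}$-bent functions from $\mathbb{F}_{2^n}$ to $\mathbb{Z}_{2^k}$.
   Context: $\mathrm{Tr}^n_1$ is the absolute trace, $\sigma(1,x)=\sum_{0\le i<j\le n-1}x^{2^i}x^{2^j}\in\mathbb{F}_2$, and for $c\in\mathbb{Z}_{2^k}$, $\sigma(c,x)=\sigma(1,x)$ if $c$ odd, $0$ if $c$ even; $\zeta_{2^k}=e^{2\pi\sqrt{ -1}/2^k}$, $i=\sqrt{ -1}$. A function $f:\mathbb{F}_{2^n}\to\mathbb{Z}_{2^k}$ is nega-$\mathbb{Z}_{2^k}$-bent if $\sum_{x\in\mathbb{F}_{2^n}}(-1)^{\mathrm{Tr}^n_1(ux)+\sigma(c,x)}\zeta_{2^k}^{cf(x)}i^{\mathrm{Tr}^n_1(c_0x)}$ has absolute value $2^{n/2}$ for all $u\in\mathbb{F}_{2^n}$ and all nonzero $c\in\mathbb{Z}_{2^k}$, where $c_0\in\{0,1\}$, $c_0\equiv c\pmod 2$ (trace values regarded as integers). -}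

module Defs where

open import Level using (0ℓ)
open import Data.Bool.Base using (Bool; true; false; if_then_else_)
open import Data.Nat.Base as ℕ using (ℕ; zero; suc; _∸_; _%_; _≡ᵇ_)
open import Data.Nat.Properties using (m^n≢0)
open import Data.Fin.Base using (Fin; toℕ)
open import Data.Integer.Base as ℤ using (ℤ; +_)
open import Data.List.Base using (List; []; _∷_; allFin; upTo; foldr)
open import Data.Product.Base using (∃; _,_)
open import Relation.Nullary using (¬_; does)
open import Relation.Binary.Definitions using (DecidableEquality)
open import Relation.Binary.PropositionalEquality using (_≡_; _≢_)
open import Algebra.Core using (Op₁; Op₂)
open import Algebra.Structures using (IsCommutativeRing)
open import Function.Bundles using (_↔_; Inverse)

-- A finite field with exactly 2^n elements (a model of F_{2^n}).
-- Any two such fields are isomorphic, so quantifying over all of them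
-- is the same as speaking about "the" field F_{2^n}.

record FiniteField2 (n : ℕ) : Set₁ where
  infixl 7 _*_
  infixl 6 _+_
  field
    Carrier           : Set
    _+_ _*_           : Op₂ Carrier
    -_                : Op₁ Carrier
    0# 1#             : Carrier
    isCommutativeRing : IsCommutativeRing _≡_ _+_ _*_ -_ 0# 1#
    0≢1               : 0# ≢ 1#
    inverse           : ∀ x → x ≢ 0# → ∃ λ y → x * y ≡ 1#
    _≟_               : DecidableEquality Carrier
    enum              : Fin (2 ℕ.^ n) ↔ Carrier

  pow : Carrier → ℕ → Carrier
  pow x zero    = 1#
  pow x (suc e) = x * pow x e

  sumL : {A : Set} → (A → Carrier) → List A → Carrier
  sumL g = foldr (λ a s → g a + s) 0#

  Tr : Carrier → Carrier
  Tr x = sumL (λ i → pow x (2 ℕ.^ i)) (upTo n)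

  σ₁ : Carrier → Carrier
  σ₁ x = sumL (λ j → sumL (λ i → pow x (2 ℕ.^ i) * pow x (2 ℕ.^ j)) (upTo j)) (upTo n)

  -- an element of the prime field F_2 ⊆ F regarded as an integer 0/1
  bit : Carrier → ℕ
  bit y = if does (y ≟ 0#) then 0 else 1

  elems : List Carrier
  elems = Data.List.Base.map (Inverse.to enum) (allFin (2 ℕ.^ n))

-- The cyclotomic ring Z[ζ_{2^k}] (k ≥ 1) represented as Z[X]/(X^m + 1),
-- m = 2^(k-1), i.e. coefficient vectors w.r.t. 1, ζ, …, ζ^(m-1).

half : ℕ → ℕ
half k = 2 ℕ.^ (k ∸ 1)

Cyc : ℕ → Set
Cyc k = Fin (half k) → ℤ

zeroC : (k : ℕ) → Cyc k
zeroC k _ = + 0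

addC : (k : ℕ) → Cyc k → Cyc k → Cyc k
addC k v w j = v j ℤ.+ w j

sumC : (k : ℕ) → {A : Set} → (A → Cyc k) → List A → Cyc k
sumC k g = foldr (λ a s → addC k (g a) s) (zeroC k)

-- z · ζ_{2^k}^e  (valid for k ≥ 1, using ζ^m = -1)
mono : (k : ℕ) → ℕ → ℤ → Cyc k
mono k e z j =
  let r = _%_ e (2 ℕ.^ k) {{m^n≢0 2 k}} in
  if toℕ j ≡ᵇ r then z
  else if (toℕ j ℕ.+ half k) ≡ᵇ r then ℤ.- z
  else + 0

mulC : (k : ℕ) → Cyc k → Cyc k → Cyc k
mulC k v w =
  sumC k (λ a → sumC k (λ b → mono k (toℕ a ℕ.+ toℕ b) (v a ℤ.* w b))
                  (allFin (half k)))
         (allFin (half k))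

-- complex conjugation: ζ ↦ ζ^{-1} = ζ^{2^k - 1}
conjC : (k : ℕ) → Cyc k → Cyc k
conjC k v = sumC k (λ a → mono k (2 ℕ.^ k ∸ toℕ a) (v a)) (allFin (half k))

module _ {n : ℕ} (F : FiniteField2 n) where
  open FiniteField2 F

  c₀F : (k : ℕ) → Fin (2 ℕ.^ k) → Carrier
  c₀F k c = if (toℕ c % 2) ≡ᵇ 0 then 0# else 1#

  σc : (k : ℕ) → Fin (2 ℕ.^ k) → Carrier → ℕ
  σc k c x = if (toℕ c % 2) ≡ᵇ 0 then 0 else bit (σ₁ x)

  -- exponent of ζ_{2^k} for the summand at x:
  -- (-1)^a = ζ^(2^(k-1) a),  i^b = ζ^(2^(k-2) b)
  expo : (k : ℕ) → (Carrier → Fin (2 ℕ.^ k)) → Carrier → Fin (2 ℕ.^ k) →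
         Carrier → ℕ
  expo k f u c x =
      2 ℕ.^ (k ∸ 1) ℕ.* (bit (Tr (u * x)) ℕ.+ σc k c x)
    ℕ.+ toℕ c ℕ.* toℕ (f x)
    ℕ.+ 2 ℕ.^ (k ∸ 2) ℕ.* bit (Tr (c₀F k c * x))

  -- Σ_x (-1)^{Tr(ux)+σ(c,x)} ζ^{c f(x)} i^{Tr(c₀ x)}  ∈ Z[ζ_{2^k}]
  negaWalsh : (k : ℕ) → (Carrier → Fin (2 ℕ.^ k)) → Carrier → Fin (2 ℕ.^ k) → Cyc k
  negaWalsh k f u c = sumC k (λ x → mono k (expo k f u c x) (+ 1)) elems

  -- |S| = 2^{n/2}  ⇔  S · conj(S) = 2^n
  NegaBent : (k : ℕ) → (Carrier → Fin (2 ℕ.^ k)) → Set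
  NegaBent k f =
    ∀ (u : Carrier) (c : Fin (2 ℕ.^ k)) → toℕ c ≢ 0 →
    ∀ (j : Fin (half k)) →
      mulC k (negaWalsh k f u c) (conjC k (negaWalsh k f u c)) j
        ≡ mono k 0 (+ (2 ℕ.^ n)) j

{-# OPTIONS --safe #-}
-- Take u = 0 and c = 2^(k-1).  Since k > 1, c is even, so c₀ = 0 and every summand of
-- the nega-Walsh sum is ζ^(2^(k-1) m) = ±1: the sum is a rational integer s.  Bentness
-- then forces s² = 2^n, impossible for odd n because 2^n ≡ 2 (mod 3) is not a square mod 3.
module Submission where

open import Defs
open import Data.Nat.Base using (ℕ; _<_; _^_; _%_)
open import Data.Fin.Base using (Fin)
open import Relation.Nullary using (¬_)
open import Relation.Binary.PropositionalEquality using (_≡_)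

open import Data.Bool.Base using (true; false)
open import Data.Nat.Base as ℕ using (zero; suc; _+_; _*_; _∸_; _≡ᵇ_; s≤s)
open import Data.Nat.Properties as ℕ
  using (m^n≢0; m^n>0; ^-monoʳ-<; +-cancelʳ-≡; m+n≡0⇒m≡0; <⇒≢; *-comm; *-assoc;
         *-distribˡ-+)
open import Data.Nat.DivMod
  using (m%n<n; %-distribˡ-*; m%n%n≡m%n; m%n*o≡m*o%[n*o]; n%n≡0; m*n%n≡0)
open import Data.Fin.Base as Fin using (toℕ; fromℕ<)
open import Data.Fin.Properties using (toℕ<n; toℕ-fromℕ<; toℕ-injective)
open import Data.Integer.Base as ℤ using (ℤ; +_)
open import Data.Integer.Properties as ℤ using (abs-*)
open import Data.List.Base using ([]; _∷_; allFin; upTo)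
open import Data.List.Relation.Unary.All using (All; []; _∷_; universal)
open import Data.List.Relation.Unary.All.Properties using (tabulate⁺)
open import Data.Sum.Base using (_⊎_; inj₁; inj₂)
open import Relation.Nullary.Decidable using (dec-true; dec-false; yes; no)
open import Relation.Nullary.Negation using (contradiction)
open import Relation.Binary.PropositionalEquality
  using (_≢_; _≗_; refl; sym; trans; cong; subst; module ≡-Reasoning)
open import Algebra.Structures using (IsCommutativeRing)
open import Function.Base using (_∘_)

open ≡-Reasoning

square%3≢2 : ∀ t → t * t % 3 ≢ 2
square%3≢2 t eq = residue (t % 3) (m%n<n t 3) (trans (sym (%-distribˡ-* t t 3)) eq)
  where
  residue : ∀ r → r < 3 → r * r % 3 ≢ 2
  residue 0 _ ()
  residue 1 _ ()
  residue 2 _ ()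
  residue (suc (suc (suc _))) (s≤s (s≤s (s≤s ())))

2^odd%3≡2 : ∀ n → n % 2 ≡ 1 → 2 ^ n % 3 ≡ 2
2^odd%3≡2 (suc zero)    _     = refl
2^odd%3≡2 (suc (suc n)) n-odd = begin
  2 * (2 * 2 ^ n) % 3  ≡⟨ cong (_% 3) (sym (*-assoc 2 2 (2 ^ n))) ⟩
  4 * 2 ^ n % 3        ≡⟨ %-distribˡ-* 4 (2 ^ n) 3 ⟩
  1 * (2 ^ n % 3) % 3  ≡⟨ cong (_% 3) (ℕ.*-identityˡ (2 ^ n % 3)) ⟩
  2 ^ n % 3 % 3        ≡⟨ m%n%n≡m%n (2 ^ n) 3 ⟩
  2 ^ n % 3            ≡⟨ 2^odd%3≡2 n n-odd ⟩
  2                    ∎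

square≢2^odd : ∀ n → n % 2 ≡ 1 → (s : ℤ) → s ℤ.* s ≢ + (2 ^ n)
square≢2^odd n n-odd s eq = square%3≢2 ℤ.∣ s ∣ (begin
  ℤ.∣ s ∣ * ℤ.∣ s ∣ % 3  ≡⟨ cong (_% 3) (sym (abs-* s s)) ⟩
  ℤ.∣ s ℤ.* s ∣ % 3      ≡⟨ cong (λ t → ℤ.∣ t ∣ % 3) eq ⟩
  2 ^ n % 3             ≡⟨ 2^odd%3≡2 n n-odd ⟩
  2                     ∎)

-- Literally the reduction performed inside `mono`, so that `with` and `rewrite` can abstract it.
_%2^_ : ℕ → ℕ → ℕ
e %2^ k = _%_ e (2 ^ k) {{m^n≢0 2 k}}

0%2^≡0 : ∀ k → 0 %2^ k ≡ 0
0%2^≡0 k = m*n%n≡0 0 (2 ^ k) {{m^n≢0 2 k}}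

≡ᵇ-false : ∀ {m n} → m ≢ n → (m ≡ᵇ n) ≡ false
≡ᵇ-false {m} {n} m≢n = dec-false (m ℕ.≟ n) m≢n

zeroF : (k : ℕ) → Fin (half k)
zeroF k = fromℕ< (m^n>0 2 (k ∸ 1))

toℕ-zeroF : ∀ k → toℕ (zeroF k) ≡ 0
toℕ-zeroF k = toℕ-fromℕ< (m^n>0 2 (k ∸ 1))

IsConstant : (k : ℕ) → Cyc k → Set
IsConstant k v = ∀ j → toℕ j ≢ 0 → v j ≡ + 0

mono-+0 : ∀ k e → mono k e (+ 0) ≗ zeroC k
mono-+0 k e j with toℕ j ≡ᵇ e %2^ k | toℕ j + half k ≡ᵇ e %2^ k
... | true  | _     = refl
... | false | true  = refl
... | false | false = refl

mono-coeff₀ : ∀ k e z j → e %2^ k ≡ 0 → toℕ j ≡ 0 → mono k e z j ≡ z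
mono-coeff₀ k e z j e≡0 j≡0 rewrite e≡0 | j≡0 = refl

mono-isConstant : ∀ k e z → e %2^ k ≡ 0 ⊎ e %2^ k ≡ half k → IsConstant k (mono k e z)
mono-isConstant k e z e%2^k∈0,h j j≢0 with e %2^ k | e%2^k∈0,h
... | _ | inj₁ refl
  rewrite ≡ᵇ-false j≢0 | ≡ᵇ-false (j≢0 ∘ m+n≡0⇒m≡0 (toℕ j) {half k}) = refl
... | _ | inj₂ refl
  rewrite ≡ᵇ-false (<⇒≢ (toℕ<n j))
        | ≡ᵇ-false (j≢0 ∘ +-cancelʳ-≡ (half k) (toℕ j) 0) = refl

isConstant⇒≗mono : ∀ k e v → e %2^ k ≡ 0 → IsConstant k v → mono k e (v (zeroF k)) ≗ v
isConstant⇒≗mono k e v e≡0 v-const j with toℕ j ℕ.≟ 0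
... | yes j≡0 = trans (mono-coeff₀ k e _ j e≡0 j≡0)
                      (cong v (toℕ-injective (trans (toℕ-zeroF k) (sym j≡0))))
... | no j≢0  = trans (mono-isConstant k e _ (inj₁ e≡0) j j≢0) (sym (v-const j j≢0))

sumC-vanishes : ∀ k {A : Set} (g : A → Cyc k) j {xs} →
                All (λ x → g x j ≡ + 0) xs → sumC k g xs j ≡ + 0
sumC-vanishes k g j []            = refl
sumC-vanishes k g j (gx≡0 ∷ rest) rewrite gx≡0 | sumC-vanishes k g j rest = refl

sumC-isConstant : ∀ k {A : Set} (g : A → Cyc k) xs →
                  (∀ x → IsConstant k (g x)) → IsConstant k (sumC k g xs)
sumC-isConstant k g xs g-const j j≢0 =
  sumC-vanishes k g j (universal (λ x → g-const x j j≢0) xs)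

sumC-allFin-single : ∀ k {N} (g : Fin N → Cyc k) j (a₀ : Fin N) → toℕ a₀ ≡ 0 →
                     (∀ a → toℕ a ≢ 0 → g a j ≡ + 0) → sumC k g (allFin N) j ≡ g a₀ j
sumC-allFin-single k g j Fin.zero _ g≡0
  rewrite sumC-vanishes k g j (tabulate⁺ (λ a → g≡0 (Fin.suc a) λ ())) =
    ℤ.+-identityʳ (g Fin.zero j)

conjC-isConstant : ∀ k v → IsConstant k v → conjC k v ≗ v
conjC-isConstant k v v-const j = begin
  conjC k v j   ≡⟨ sumC-allFin-single k term j 0ₖ (toℕ-zeroF k) other-terms ⟩
  term 0ₖ j     ≡⟨ isConstant⇒≗mono k _ v 2^k∸0%2^k≡0 v-const j ⟩
  v j           ∎
  where
  0ₖ = zeroF k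
  term : Fin (half k) → Cyc k
  term a = mono k (2 ^ k ∸ toℕ a) (v a)
  other-terms : ∀ a → toℕ a ≢ 0 → term a j ≡ + 0
  other-terms a a≢0 rewrite v-const a a≢0 = mono-+0 k _ j
  2^k∸0%2^k≡0 : (2 ^ k ∸ toℕ 0ₖ) %2^ k ≡ 0
  2^k∸0%2^k≡0 rewrite toℕ-zeroF k = n%n≡0 (2 ^ k) {{m^n≢0 2 k}}

mulC-isConstant-coeff₀ : ∀ k v w → IsConstant k v → IsConstant k w →
                         mulC k v w (zeroF k) ≡ v (zeroF k) ℤ.* w (zeroF k)
mulC-isConstant-coeff₀ k v w v-const w-const = begin
  mulC k v w 0ₖ    ≡⟨ sumC-allFin-single k row 0ₖ 0ₖ (toℕ-zeroF k) other-rows ⟩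
  row 0ₖ 0ₖ        ≡⟨ sumC-allFin-single k (term 0ₖ) 0ₖ 0ₖ (toℕ-zeroF k) other-columns ⟩
  term 0ₖ 0ₖ 0ₖ    ≡⟨ mono-coeff₀ k _ _ 0ₖ 0+0%2^k≡0 (toℕ-zeroF k) ⟩
  v 0ₖ ℤ.* w 0ₖ    ∎
  where
  0ₖ = zeroF k
  term : Fin (half k) → Fin (half k) → Cyc k
  term a b = mono k (toℕ a + toℕ b) (v a ℤ.* w b)
  row : Fin (half k) → Cyc k
  row a = sumC k (term a) (allFin (half k))
  other-rows : ∀ a → toℕ a ≢ 0 → row a 0ₖ ≡ + 0
  other-rows a a≢0 = sumC-vanishes k (term a) 0ₖ (universal vanish (allFin (half k)))
    where
    vanish : ∀ b → term a b 0ₖ ≡ + 0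
    vanish b rewrite v-const a a≢0 = mono-+0 k _ 0ₖ
  other-columns : ∀ b → toℕ b ≢ 0 → term 0ₖ b 0ₖ ≡ + 0
  other-columns b b≢0 rewrite w-const b b≢0 | ℤ.*-zeroʳ (v 0ₖ) = mono-+0 k _ 0ₖ
  0+0%2^k≡0 : (toℕ 0ₖ + toℕ 0ₖ) %2^ k ≡ 0
  0+0%2^k≡0 rewrite toℕ-zeroF k = 0%2^≡0 k

mulC-conjC-isConstant : ∀ k v → IsConstant k v →
                        mulC k v (conjC k v) (zeroF k) ≡ v (zeroF k) ℤ.* v (zeroF k)
mulC-conjC-isConstant k v v-const = begin
  mulC k v (conjC k v) 0ₖ    ≡⟨ mulC-isConstant-coeff₀ k v (conjC k v) v-const conj-const ⟩
  v 0ₖ ℤ.* conjC k v 0ₖ      ≡⟨ cong (v 0ₖ ℤ.*_) (conjC-isConstant k v v-const 0ₖ) ⟩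
  v 0ₖ ℤ.* v 0ₖ              ∎
  where
  0ₖ = zeroF k
  conj-const : IsConstant k (conjC k v)
  conj-const j j≢0 = trans (conjC-isConstant k v v-const j) (v-const j j≢0)

mono-2^*-isConstant : ∀ k m z → IsConstant (suc k) (mono (suc k) (2 ^ k * m) z)
mono-2^*-isConstant k m z = mono-isConstant (suc k) _ z (parity (m % 2) (m%n<n m 2) reduced)
  where
  reduced : (2 ^ k * m) %2^ suc k ≡ m % 2 * 2 ^ k
  reduced = begin
    (2 ^ k * m) %2^ suc k  ≡⟨ cong (_%2^ suc k) (*-comm (2 ^ k) m) ⟩
    (m * 2 ^ k) %2^ suc k  ≡⟨ sym (m%n*o≡m*o%[n*o] m 2 (2 ^ k) {{_}} {{m^n≢0 2 (suc k)}}) ⟩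
    m % 2 * 2 ^ k          ∎
  parity : ∀ {e} r → r < 2 → e ≡ r * 2 ^ k → e ≡ 0 ⊎ e ≡ 2 ^ k
  parity 0 _ e≡0 = inj₁ e≡0
  parity 1 _ e≡h = inj₂ (trans e≡h (ℕ.+-identityʳ (2 ^ k)))
  parity (suc (suc _)) (s≤s (s≤s ())) _

halfF : ∀ k → Fin (2 ^ suc k)
halfF k = fromℕ< (^-monoʳ-< 2 ℕ.≤-refl (ℕ.n<1+n k))

toℕ-halfF : ∀ k → toℕ (halfF k) ≡ 2 ^ k
toℕ-halfF k = toℕ-fromℕ< (^-monoʳ-< 2 ℕ.≤-refl (ℕ.n<1+n k))

module _ {n : ℕ} (F : FiniteField2 n) where
  open FiniteField2 F using (Carrier; 0#; _≟_; pow; sumL; Tr; bit; elems; isCommutativeRing)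
    renaming (_*_ to _·_)
  open IsCommutativeRing isCommutativeRing using (zeroˡ; +-identityˡ)

  bit-0# : bit 0# ≡ 0
  bit-0# rewrite dec-true (0# ≟ 0#) refl = refl

  pow-0# : ∀ e → e ≢ 0 → pow 0# e ≡ 0#
  pow-0# zero    e≢0 = contradiction refl e≢0
  pow-0# (suc e) _   = zeroˡ (pow 0# e)

  sumL-vanishes : ∀ {A : Set} (g : A → Carrier) xs → (∀ a → g a ≡ 0#) → sumL g xs ≡ 0#
  sumL-vanishes g []       _    = refl
  sumL-vanishes g (a ∷ xs) g≡0 rewrite g≡0 a | sumL-vanishes g xs g≡0 = +-identityˡ 0#

  Tr-0# : Tr 0# ≡ 0#
  Tr-0# = sumL-vanishes _ (upTo n) λ i →
    pow-0# (2 ^ i) (ℕ.≢-nonZero⁻¹ (2 ^ i) {{m^n≢0 2 i}})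

  c₀F-even : ∀ k c → toℕ c % 2 ≡ 0 → c₀F F k c ≡ 0#
  c₀F-even k c c-even rewrite c-even = refl

  bit-Tr-c₀F-even : ∀ k c x → toℕ c % 2 ≡ 0 → bit (Tr (c₀F F k c · x)) ≡ 0
  bit-Tr-c₀F-even k c x c-even = begin
    bit (Tr (c₀F F k c · x))  ≡⟨ cong (λ y → bit (Tr (y · x))) (c₀F-even k c c-even) ⟩
    bit (Tr (0# · x))         ≡⟨ cong (bit ∘ Tr) (zeroˡ x) ⟩
    bit (Tr 0#)               ≡⟨ cong bit Tr-0# ⟩
    bit 0#                    ≡⟨ bit-0# ⟩
    0                         ∎

  expo-even : ∀ k f u c x → toℕ c % 2 ≡ 0 →
              expo F k f u c x ≡ half k * (bit (Tr (u · x)) + σc F k c x) + toℕ c * toℕ (f x)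
  expo-even k f u c x c-even
    rewrite bit-Tr-c₀F-even k c x c-even | ℕ.*-zeroʳ (2 ^ (k ∸ 2)) = ℕ.+-identityʳ _

  negaWalsh-halfF-isConstant : ∀ k f u →
    IsConstant (suc (suc k)) (negaWalsh F (suc (suc k)) f u (halfF (suc k)))
  negaWalsh-halfF-isConstant k f u =
    sumC-isConstant K _ elems λ x →
      subst (λ e → IsConstant K (mono K e (+ 1))) (sym (expo-2^* x))
            (mono-2^*-isConstant (suc k) _ (+ 1))
    where
    K = suc (suc k)
    c = halfF (suc k)
    c-even : toℕ c % 2 ≡ 0
    c-even rewrite toℕ-halfF (suc k) = trans (cong (_% 2) (*-comm 2 (2 ^ k))) (m*n%n≡0 (2 ^ k) 2)
    expo-2^* : ∀ x →
               expo F K f u c x ≡ 2 ^ suc k * (bit (Tr (u · x)) + σc F K c x + toℕ (f x))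
    expo-2^* x rewrite expo-even K f u c x c-even | toℕ-halfF (suc k) =
      sym (*-distribˡ-+ (2 ^ suc k) _ (toℕ (f x)))

corollary3p20 : (k n : ℕ) → 1 < k → n % 2 ≡ 1 → (F : FiniteField2 n) →
    (f : FiniteField2.Carrier F → Fin (2 ^ k)) →
    ¬ NegaBent F k f
corollary3p20 (suc (suc k)) n _ n-odd F f bent = square≢2^odd n n-odd (W 0ₖ) (begin
  W 0ₖ ℤ.* W 0ₖ                ≡⟨ mulC-conjC-isConstant K W W-isConstant ⟨
  mulC K W (conjC K W) 0ₖ      ≡⟨ bent u c c≢0 0ₖ ⟩
  mono K 0 (+ (2 ^ n)) 0ₖ      ≡⟨ mono-coeff₀ K 0 _ 0ₖ (0%2^≡0 K) (toℕ-zeroF K) ⟩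
  + (2 ^ n)                    ∎)
  where
  K = suc (suc k)
  0ₖ = zeroF K
  u = FiniteField2.0# F
  c = halfF (suc k)
  c≢0 : toℕ c ≢ 0
  c≢0 rewrite toℕ-halfF (suc k) = ℕ.≢-nonZero⁻¹ (2 ^ suc k) {{m^n≢0 2 (suc k)}}
  W = negaWalsh F K f u c
  W-isConstant : IsConstant K W
  W-isConstant = negaWalsh-halfF-isConstant F k f u
corollary3p20 (suc zero) n (s≤s ()) _ _ _
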